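{- Let $n\ge1$ and for a permutation $w\in S_n$ viewed as a word define $N(w)=\sum_{k=1}^{n-1}k(n-k)\gamma_{k,k+1}(w)-\sum_{1\le i<j\le n}\gamma_{ij}(w)$. Then: (i) if $w,w'\in S_n$ are conjugate words, then $N(w)=N(w')$; (ii) if $w$ has a circular factor $sr$ with $s,r\in\{1,\ldots,n\}$, $s>r+1$, and $w'$ is obtained from $w$ by exchanging the letters $r$ and $s$, then $N(w')=N(w)+1$; (iii) $N(1\,2\cdots n)=0$; (iv) $N(n\cdots 2\,1)=\binom{n}{3}$.
   Context: Permutations $w\in S_n$ are viewed as words on the alphabet $\{1,\ldots,n\}$. A conjugate of a word $w$ is a word $yx$ where $w=xy$. A circular factor of $w$ is a factor (contiguous subword) of some conjugate of $w$. For $1\le i<j\le n$, $\gamma_{ij}(w)=1$ if $j$ appears before $i$ in the word $w$, and $\gamma_{ij}(w)=0$ otherwise. -}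

module Defs where

open import Data.Nat using (ℕ; zero; suc; _+_; _*_; _∸_; _<ᵇ_; _≡ᵇ_)
open import Data.Bool using (if_then_else_)
open import Data.List using (List; []; _∷_; _++_; map; upTo)
open import Data.Nat.ListAction using (sum)
open import Data.List.Relation.Binary.Permutation.Propositional using (_↭_)
open import Data.Product using (Σ; ∃; _×_)
open import Data.Integer using (ℤ; +_; _-_)
open import Relation.Binary.PropositionalEquality using (_≡_)

letters : ℕ → List ℕ
letters n = map suc (upTo n)

IsPerm : ℕ → List ℕ → Set
IsPerm n w = w ↭ letters n

-- position (0-based) of the first occurrence of a letter in a word
pos : ℕ → List ℕ → ℕ
pos a [] = 0
pos a (x ∷ w) = if x ≡ᵇ a then 0 else suc (pos a w)

γ : ℕ → ℕ → List ℕ → ℕ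
γ i j w = if pos j w <ᵇ pos i w then 1 else 0

Nfirst : ℕ → List ℕ → ℕ
Nfirst n w = sum (map (λ k → k * (n ∸ k) * γ k (suc k) w) (letters (n ∸ 1)))

Nsecond : ℕ → List ℕ → ℕ
Nsecond n w = sum (map (λ i → sum (map (λ t → γ i (i + suc t) w) (upTo (n ∸ i)))) (letters n))

N : ℕ → List ℕ → ℤ
N n w = + Nfirst n w - + Nsecond n w

Conjugate : List ℕ → List ℕ → Set
Conjugate w w' = Σ (List ℕ) λ x → Σ (List ℕ) λ y → (w ≡ x ++ y) × (w' ≡ y ++ x)

CircularFactor : List ℕ → List ℕ → Set
CircularFactor u w = Σ (List ℕ) λ c → Conjugate w c ×
  (Σ (List ℕ) λ a → Σ (List ℕ) λ b → c ≡ a ++ u ++ b)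

swapLetter : ℕ → ℕ → ℕ → ℕ
swapLetter r s x = if x ≡ᵇ r then s else (if x ≡ᵇ s then r else x)

exchange : ℕ → ℕ → List ℕ → List ℕ
exchange r s w = map (swapLetter r s) w

-- Rotating a word, i.e. moving its first letter a to the end, creates the
-- inversions (a, j) with j > a and destroys the inversions (i, a) with i < a,
-- so the second sum of N grows by (n - a) - (a - 1).  In the first sum only the
-- terms k = a and k = a - 1 change, and by a(n - a) - (a - 1)(n - a + 1), which
-- is the same amount; hence N is constant on conjugacy classes.  For (ii) we may
-- therefore rotate the factor s r to the front of the word.  There exchanging
-- r and s changes the inversion (r, s) and nothing else, since every other
-- letter lies on the same side of both; as s > r + 1 this pair is not of the
-- form (k, k + 1), so only the second sum drops, by one.  Parts (iii) and (iv)
-- are direct computations, the latter using Σ_{k=1}^{n} k(n - k) = C(n+1, 3).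
module Submission where

open import Defs
open import Data.Bool using (Bool; true; false; if_then_else_; _∧_)
open import Data.Bool.Properties using (T-≡; ¬-not)
open import Data.Nat
open import Data.Nat.Properties
open import Data.Nat.ListAction using (sum)
open import Data.Nat.ListAction.Properties using (sum-++)
open import Data.Nat.Combinatorics using (_C_; nC1≡n; nCk+nC[k+1]≡[n+1]C[k+1])
open import Data.Nat.Tactic.RingSolver as ℕ-Solver using ()
open import Data.List using (List; []; _∷_; _++_; [_]; map; upTo; downFrom; length; reverse)
open import Data.List.Properties
  using (map-∘; map-++; map-upTo; upTo-∷ʳ; length-upTo; reverse-map; reverse-upTo; ++-assoc; ++-identityʳ)
open import Data.List.Membership.Propositional using (_∈_; _∉_)
open import Data.List.Membership.Propositional.Properties using (∈-map⁺; ∈-map⁻; ∈-upTo⁺; ∈-upTo⁻)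
open import Data.List.Membership.DecPropositional _≟_ using (_∈?_)
open import Data.List.Relation.Unary.Any using (here; there; tail)
import Data.List.Relation.Unary.All as All
open import Data.List.Relation.Unary.AllPairs using (_∷_)
open import Data.List.Relation.Unary.Unique.Propositional using (Unique)
import Data.List.Relation.Unary.Unique.Propositional.Properties as Uniqueₚ
open import Data.List.Relation.Binary.Permutation.Propositional using (_↭_; ↭-sym; ↭⇒↭ₛ)
open import Data.List.Relation.Binary.Permutation.Propositional.Properties using (∈-resp-↭; ∷↭∷ʳ; ++-comm)
import Data.List.Relation.Binary.Permutation.Setoid.Properties as Permₛ
open import Data.Integer as ℤ using (ℤ)
open import Data.Integer.Tactic.RingSolver using (solve-∀)
open import Data.Product using (∃; _×_; _,_; proj₁; proj₂)
open import Data.Empty using (⊥-elim)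
open import Function using (_∘_; Equivalence)
open import Relation.Nullary using (yes; no)
open import Relation.Binary.PropositionalEquality hiding ([_])
open import Algebra.Properties.CommutativeSemigroup +-commutativeSemigroup using (interchange)

open ≡-Reasoning

𝟙 : Bool → ℕ
𝟙 b = if b then 1 else 0

weight : ℕ → ℕ → ℕ
weight n k = k * (n ∸ k)

weight-self : ∀ n → weight n n ≡ 0
weight-self n = trans (cong (n *_) (n∸n≡0 n)) (*-zeroʳ n)

≡ᵇ-refl : ∀ a → (a ≡ᵇ a) ≡ true
≡ᵇ-refl a = Equivalence.to T-≡ (≡⇒≡ᵇ a a refl)

≢⇒≡ᵇ-false : ∀ {x a} → x ≢ a → (x ≡ᵇ a) ≡ false
≢⇒≡ᵇ-false {x} {a} x≢a = ¬-not λ x≡ᵇa → x≢a (≡ᵇ⇒≡ x a (Equivalence.from T-≡ x≡ᵇa))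

<⇒<ᵇ-true : ∀ {x a} → x < a → (x <ᵇ a) ≡ true
<⇒<ᵇ-true x<a = Equivalence.to T-≡ (<⇒<ᵇ x<a)

≥⇒<ᵇ-false : ∀ {x a} → a ≤ x → (x <ᵇ a) ≡ false
≥⇒<ᵇ-false {x} {a} a≤x = ¬-not λ x<ᵇa → ≤⇒≯ a≤x (<ᵇ⇒< x a (Equivalence.from T-≡ x<ᵇa))

sum-map-cong : ∀ xs {f g : ℕ → ℕ} → (∀ {x} → x ∈ xs → f x ≡ g x) →
               sum (map f xs) ≡ sum (map g xs)
sum-map-cong []       f≡g = refl
sum-map-cong (x ∷ xs) f≡g = cong₂ _+_ (f≡g (here refl)) (sum-map-cong xs λ x∈ → f≡g (there x∈))

sum-map-+ : ∀ xs (f g : ℕ → ℕ) →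
            sum (map (λ x → f x + g x) xs) ≡ sum (map f xs) + sum (map g xs)
sum-map-+ []       f g = refl
sum-map-+ (x ∷ xs) f g =
  trans (cong (f x + g x +_) (sum-map-+ xs f g)) (interchange (f x) (g x) _ _)

sum-map-zero : ∀ xs {f : ℕ → ℕ} → (∀ {x} → x ∈ xs → f x ≡ 0) → sum (map f xs) ≡ 0
sum-map-zero []       f≡0 = refl
sum-map-zero (x ∷ xs) f≡0 = cong₂ _+_ (f≡0 (here refl)) (sum-map-zero xs λ x∈ → f≡0 (there x∈))

sum-map-one : ∀ (xs : List ℕ) → sum (map (λ _ → 1) xs) ≡ length xs
sum-map-one []       = refl
sum-map-one (x ∷ xs) = cong suc (sum-map-one xs)

sum-map-point : ∀ {xs a} {f : ℕ → ℕ} → Unique xs → a ∈ xs →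
                (∀ {x} → x ∈ xs → x ≢ a → f x ≡ 0) → sum (map f xs) ≡ f a
sum-map-point {x ∷ xs} {f = f} (x≢xs ∷ _) (here refl) f≡0 =
  trans (cong (f x +_) (sum-map-zero xs λ y∈ → f≡0 (there y∈) (≢-sym (All.lookup x≢xs y∈))))
        (+-identityʳ (f x))
sum-map-point (x≢xs ∷ xs-unique) (there a∈) f≡0 =
  cong₂ _+_ (f≡0 (here refl) (All.lookup x≢xs a∈)) (sum-map-point xs-unique a∈ λ y∈ → f≡0 (there y∈))

∈∧∉⇒≢ : ∀ {x a} {u : List ℕ} → x ∈ u → a ∉ u → x ≢ a
∈∧∉⇒≢ x∈u a∉u x≡a = a∉u (subst (_∈ _) x≡a x∈u)

*-𝟙-≢ : ∀ c {x a} → x ≢ a → c * 𝟙 (x ≡ᵇ a) ≡ 0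
*-𝟙-≢ c x≢a = trans (cong (λ b → c * 𝟙 b) (≢⇒≡ᵇ-false x≢a)) (*-zeroʳ c)

letters-suc : ∀ n → letters (suc n) ≡ 1 ∷ map suc (letters n)
letters-suc n = cong (λ xs → 1 ∷ map suc xs) (sym (map-upTo suc n))

letters-∷ʳ : ∀ n → letters (suc n) ≡ letters n ++ [ suc n ]
letters-∷ʳ n = trans (cong (map suc) (sym (upTo-∷ʳ n))) (map-++ suc (upTo n) [ n ])

sum-letters-suc : ∀ n (f : ℕ → ℕ) →
                  sum (map f (letters (suc n))) ≡ f 1 + sum (map (f ∘ suc) (letters n))
sum-letters-suc n f =
  trans (cong (sum ∘ map f) (letters-suc n)) (cong (λ xs → f 1 + sum xs) (sym (map-∘ (letters n))))

sum-letters-∷ʳ : ∀ n (f : ℕ → ℕ) →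
                 sum (map f (letters (suc n))) ≡ sum (map f (letters n)) + f (suc n)
sum-letters-∷ʳ n f = begin
  sum (map f (letters (suc n)))              ≡⟨ cong (sum ∘ map f) (letters-∷ʳ n) ⟩
  sum (map f (letters n ++ [ suc n ]))       ≡⟨ cong sum (map-++ f (letters n) [ suc n ]) ⟩
  sum (map f (letters n) ++ [ f (suc n) ])   ≡⟨ sum-++ (map f (letters n)) [ f (suc n) ] ⟩
  sum (map f (letters n)) + (f (suc n) + 0)  ≡⟨ cong (sum (map f (letters n)) +_) (+-identityʳ _) ⟩
  sum (map f (letters n)) + f (suc n)        ∎

∈-letters⁻ : ∀ {n x} → x ∈ letters n → 1 ≤ x × x ≤ n
∈-letters⁻ x∈ with t , t∈ , refl ← ∈-map⁻ suc x∈ = s≤s z≤n , ∈-upTo⁻ t∈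

∈-letters⁺ : ∀ {n x} → 1 ≤ x → x ≤ n → x ∈ letters n
∈-letters⁺ {x = suc t} _ t<n = ∈-map⁺ suc (∈-upTo⁺ t<n)

∈-letters-pred⁻ : ∀ {n k} → k ∈ letters (n ∸ 1) → 1 ≤ k × suc k ≤ n
∈-letters-pred⁻ {suc n} k∈ with 1≤k , k≤n ← ∈-letters⁻ k∈ = 1≤k , s≤s k≤n

letters-unique : ∀ n → Unique (letters n)
letters-unique n = Uniqueₚ.map⁺ suc-injective (Uniqueₚ.upTo⁺ n)

sumPairs : ℕ → (ℕ → ℕ → ℕ) → ℕ
sumPairs n g = sum (map (λ i → sum (map (λ t → g i (i + suc t)) (upTo (n ∸ i)))) (letters n))

sumPairs-cong : ∀ n {g h : ℕ → ℕ → ℕ} → (∀ {i j} → 1 ≤ i → i < j → j ≤ n → g i j ≡ h i j) →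
                sumPairs n g ≡ sumPairs n h
sumPairs-cong n g≡h = sum-map-cong (letters n) λ {i} i∈ → sum-map-cong (upTo (n ∸ i)) λ {t} t∈ →
  let 1≤i , i≤n = ∈-letters⁻ i∈ in
  g≡h 1≤i (m<m+n i z<s) (subst (i + suc t ≤_) (m+[n∸m]≡n i≤n) (+-monoʳ-≤ i (∈-upTo⁻ t∈)))

sumPairs-+ : ∀ n (g h : ℕ → ℕ → ℕ) →
             sumPairs n (λ i j → g i j + h i j) ≡ sumPairs n g + sumPairs n h
sumPairs-+ n g h = trans
  (sum-map-cong (letters n) λ {i} _ → sum-map-+ (upTo (n ∸ i)) (g′ i) (h′ i))
  (sum-map-+ (letters n) (λ i → sum (map (g′ i) (upTo (n ∸ i)))) (λ i → sum (map (h′ i) (upTo (n ∸ i)))))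
  where
  g′ h′ : ℕ → ℕ → ℕ
  g′ i t = g i (i + suc t)
  h′ i t = h i (i + suc t)

sumPairs-zero : ∀ n → sumPairs n (λ _ _ → 0) ≡ 0
sumPairs-zero n = sum-map-zero (letters n) λ {i} _ → sum-map-zero (upTo (n ∸ i)) λ _ → refl

sum-above : ∀ i {a m} → a ≤ i + m → sum (map (λ t → 𝟙 (i + suc t ≡ᵇ a)) (upTo m)) ≡ 𝟙 (i <ᵇ a)
sum-above zero    {zero}  {m} _ = sum-map-zero (upTo m) λ _ → refl
sum-above zero    {suc a} {m} a<m = trans
  (sum-map-point (Uniqueₚ.upTo⁺ m) (∈-upTo⁺ a<m) λ _ t≢a → cong 𝟙 (≢⇒≡ᵇ-false t≢a))
  (cong 𝟙 (≡ᵇ-refl a))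
sum-above (suc i) {zero}  {m} _ = sum-map-zero (upTo m) λ _ → refl
sum-above (suc i) {suc a} (s≤s a≤i+m) = sum-above i a≤i+m

count-below : ∀ n {a} → a ≤ suc n → sum (map (λ i → 𝟙 (i <ᵇ a)) (letters n)) ≡ a ∸ 1
count-below zero    a≤1 = sym (m≤n⇒m∸n≡0 a≤1)
count-below (suc n) {zero}  _ = sum-map-zero (letters (suc n)) λ _ → refl
count-below (suc n) {suc a} (s≤s a≤1+n) = begin
  sum (map (λ i → 𝟙 (i <ᵇ suc a)) (letters (suc n)))    ≡⟨ sum-letters-suc n _ ⟩
  𝟙 (0 <ᵇ a) + sum (map (λ i → 𝟙 (i <ᵇ a)) (letters n)) ≡⟨ cong (_ +_) (count-below n a≤1+n) ⟩
  𝟙 (0 <ᵇ a) + (a ∸ 1)                                   ≡⟨ 𝟙[0<m]+[m∸1]≡m a ⟩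
  a                                                      ∎
  where
  𝟙[0<m]+[m∸1]≡m : ∀ m → 𝟙 (0 <ᵇ m) + (m ∸ 1) ≡ m
  𝟙[0<m]+[m∸1]≡m zero    = refl
  𝟙[0<m]+[m∸1]≡m (suc m) = refl

sumPairs-larger : ∀ n {a} → 1 ≤ a → a ≤ n → sumPairs n (λ i _ → 𝟙 (i ≡ᵇ a)) ≡ n ∸ a
sumPairs-larger n {a} 1≤a a≤n = begin
  sumPairs n (λ i _ → 𝟙 (i ≡ᵇ a))
    ≡⟨ sum-map-point (letters-unique n) (∈-letters⁺ 1≤a a≤n)
         (λ {i} _ i≢a → sum-map-zero (upTo (n ∸ i)) λ _ → cong 𝟙 (≢⇒≡ᵇ-false i≢a)) ⟩
  sum (map (λ _ → 𝟙 (a ≡ᵇ a)) (upTo (n ∸ a)))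
    ≡⟨ cong (λ b → sum (map (λ _ → 𝟙 b) (upTo (n ∸ a)))) (≡ᵇ-refl a) ⟩
  sum (map (λ _ → 1) (upTo (n ∸ a)))  ≡⟨ sum-map-one (upTo (n ∸ a)) ⟩
  length (upTo (n ∸ a))               ≡⟨ length-upTo (n ∸ a) ⟩
  n ∸ a                               ∎

sumPairs-smaller : ∀ n {a} → a ≤ n → sumPairs n (λ _ j → 𝟙 (j ≡ᵇ a)) ≡ a ∸ 1
sumPairs-smaller n a≤n = trans
  (sum-map-cong (letters n) λ {i} _ → sum-above i (≤-trans a≤n (m≤n+m∸n n i)))
  (count-below n (m≤n⇒m≤1+n a≤n))

sumPairs-single : ∀ n {r s} → 1 ≤ r → r < s → s ≤ n →
                  sumPairs n (λ i j → 𝟙 ((i ≡ᵇ r) ∧ (j ≡ᵇ s))) ≡ 1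
sumPairs-single n {r} {s} 1≤r r<s s≤n = begin
  sumPairs n (λ i j → 𝟙 ((i ≡ᵇ r) ∧ (j ≡ᵇ s)))
    ≡⟨ sum-map-point (letters-unique n) (∈-letters⁺ 1≤r (<⇒≤ (<-≤-trans r<s s≤n)))
         (λ {i} _ i≢r → sum-map-zero (upTo (n ∸ i)) λ {t} _ →
            cong (λ b → 𝟙 (b ∧ (i + suc t ≡ᵇ s))) (≢⇒≡ᵇ-false i≢r)) ⟩
  sum (map (λ t → 𝟙 ((r ≡ᵇ r) ∧ (r + suc t ≡ᵇ s))) (upTo (n ∸ r)))
    ≡⟨ sum-map-cong (upTo (n ∸ r)) (λ {t} _ →
         cong (λ b → 𝟙 (b ∧ (r + suc t ≡ᵇ s))) (≡ᵇ-refl r)) ⟩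
  sum (map (λ t → 𝟙 (r + suc t ≡ᵇ s)) (upTo (n ∸ r)))
    ≡⟨ sum-above r (≤-trans s≤n (m≤n+m∸n n r)) ⟩
  𝟙 (r <ᵇ s) ≡⟨ cong 𝟙 (<⇒<ᵇ-true r<s) ⟩
  1          ∎

weight-outside : ∀ {n a} → a ≤ n → a ∉ letters (n ∸ 1) → weight n a ≡ 0
weight-outside {n}     {zero}  _       _ = refl
weight-outside {suc m} {suc b} (s≤s b≤m) a∉ with b ≟ m
... | yes refl = weight-self (suc b)
... | no  b≢m  = ⊥-elim (a∉ (∈-letters⁺ (s≤s z≤n) (≤∧≢⇒< b≤m b≢m)))

sum-weight-select : ∀ n {a} → a ≤ n →
                    sum (map (λ k → weight n k * 𝟙 (k ≡ᵇ a)) (letters (n ∸ 1))) ≡ weight n a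
sum-weight-select n {a} a≤n with a ∈? letters (n ∸ 1)
... | yes a∈ = trans
  (sum-map-point (letters-unique (n ∸ 1)) a∈ λ {k} _ k≢a → *-𝟙-≢ (weight n k) k≢a)
  (trans (cong (λ b → weight n a * 𝟙 b) (≡ᵇ-refl a)) (*-identityʳ (weight n a)))
... | no  a∉ = trans
  (sum-map-zero (letters (n ∸ 1)) λ {k} k∈ → *-𝟙-≢ (weight n k) (∈∧∉⇒≢ k∈ a∉))
  (sym (weight-outside a≤n a∉))

-- w′ has the inversions of w, plus all pairs (a, j) and minus all pairs (i, a).
MovesLast : ℕ → ℕ → List ℕ → List ℕ → Set
MovesLast n a w w′ =
  ∀ {i j} → 1 ≤ i → i < j → j ≤ n → γ i j w + 𝟙 (i ≡ᵇ a) ≡ γ i j w′ + 𝟙 (j ≡ᵇ a)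

Nsecond-movesLast : ∀ {n a w w′} → 1 ≤ a → a ≤ n → MovesLast n a w w′ →
                    Nsecond n w + (n ∸ a) ≡ Nsecond n w′ + (a ∸ 1)
Nsecond-movesLast {n} {a} {w} {w′} 1≤a a≤n moves = begin
  Nsecond n w + (n ∸ a)
    ≡⟨ cong (Nsecond n w +_) (sumPairs-larger n 1≤a a≤n) ⟨
  Nsecond n w + sumPairs n (λ i _ → 𝟙 (i ≡ᵇ a))
    ≡⟨ sumPairs-+ n (λ i j → γ i j w) (λ i _ → 𝟙 (i ≡ᵇ a)) ⟨
  sumPairs n (λ i j → γ i j w + 𝟙 (i ≡ᵇ a))
    ≡⟨ sumPairs-cong n moves ⟩
  sumPairs n (λ i j → γ i j w′ + 𝟙 (j ≡ᵇ a))
    ≡⟨ sumPairs-+ n (λ i j → γ i j w′) (λ _ j → 𝟙 (j ≡ᵇ a)) ⟩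
  Nsecond n w′ + sumPairs n (λ _ j → 𝟙 (j ≡ᵇ a))
    ≡⟨ cong (Nsecond n w′ +_) (sumPairs-smaller n a≤n) ⟩
  Nsecond n w′ + (a ∸ 1) ∎

Nfirst-movesLast : ∀ {n a w w′} → 1 ≤ a → a ≤ n → MovesLast n a w w′ →
                   Nfirst n w + weight n a ≡ Nfirst n w′ + weight n (a ∸ 1)
Nfirst-movesLast {n} {suc b} {w} {w′} _ a≤n moves = begin
  Nfirst n w + weight n (suc b)
    ≡⟨ cong (Nfirst n w +_) (sum-weight-select n a≤n) ⟨
  Nfirst n w + sum (map (λ k → weight n k * 𝟙 (k ≡ᵇ suc b)) ks)
    ≡⟨ sum-map-+ ks (λ k → weight n k * γ k (suc k) w) (λ k → weight n k * 𝟙 (k ≡ᵇ suc b)) ⟨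
  sum (map (λ k → weight n k * γ k (suc k) w + weight n k * 𝟙 (k ≡ᵇ suc b)) ks)
    ≡⟨ sum-map-cong ks adjacent ⟩
  sum (map (λ k → weight n k * γ k (suc k) w′ + weight n k * 𝟙 (k ≡ᵇ b)) ks)
    ≡⟨ sum-map-+ ks (λ k → weight n k * γ k (suc k) w′) (λ k → weight n k * 𝟙 (k ≡ᵇ b)) ⟩
  Nfirst n w′ + sum (map (λ k → weight n k * 𝟙 (k ≡ᵇ b)) ks)
    ≡⟨ cong (Nfirst n w′ +_) (sum-weight-select n (≤-trans (n≤1+n b) a≤n)) ⟩
  Nfirst n w′ + weight n b ∎
  where
  ks = letters (n ∸ 1)
  adjacent : ∀ {k} → k ∈ ks → weight n k * γ k (suc k) w + weight n k * 𝟙 (k ≡ᵇ suc b)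
                            ≡ weight n k * γ k (suc k) w′ + weight n k * 𝟙 (k ≡ᵇ b)
  adjacent {k} k∈ with 1≤k , 1+k≤n ← ∈-letters-pred⁻ k∈ =
    trans (sym (*-distribˡ-+ (weight n k) _ _))
          (trans (cong (weight n k *_) (moves 1≤k (n<1+n k) 1+k≤n)) (*-distribˡ-+ (weight n k) _ _))

weight-step : ∀ {n a} → 1 ≤ a → a ≤ n → weight n a + (a ∸ 1) ≡ weight n (a ∸ 1) + (n ∸ a)
weight-step {n} {suc b} _ b<n = begin
  suc b * m + b        ≡⟨ expand b m ⟩
  b * suc m + m        ≡⟨ cong (λ x → b * x + m) (+-∸-assoc 1 b<n) ⟨
  b * (n ∸ b) + m      ∎
  where
  m = n ∸ suc b
  expand : ∀ b m → suc b * m + b ≡ b * suc m + m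
  expand = ℕ-Solver.solve-∀

+-cancel-balanced : ∀ {F F′ S S′ W W′ D D′ : ℕ} →
                    F + W ≡ F′ + W′ → S + D ≡ S′ + D′ → W + D′ ≡ W′ + D → F + S′ ≡ F′ + S
+-cancel-balanced {F} {F′} {S} {S′} {W} {W′} {D} {D′} eF eS eW =
  +-cancelʳ-≡ (W′ + D) (F + S′) (F′ + S) (begin
  (F + S′) + (W′ + D)   ≡⟨ cong ((F + S′) +_) eW ⟨
  (F + S′) + (W + D′)   ≡⟨ interchange F S′ W D′ ⟩
  (F + W) + (S′ + D′)   ≡⟨ cong₂ _+_ eF (sym eS) ⟩
  (F′ + W′) + (S + D)   ≡⟨ interchange F′ W′ S D ⟩
  (F′ + S) + (W′ + D)   ∎)

N-cong : ∀ {n w w′ W W′ D D′} →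
         Nfirst n w + W ≡ Nfirst n w′ + W′ → Nsecond n w + D ≡ Nsecond n w′ + D′ → W + D′ ≡ W′ + D →
         N n w ≡ N n w′
N-cong {n} {w} {w′} {W} {W′} {D} {D′} eF eS eW = begin
  ℤ.+ F ℤ.- ℤ.+ S                      ≡⟨ add-right (ℤ.+ F) (ℤ.+ S) (ℤ.+ S′) ⟩
  ℤ.+ (F + S′) ℤ.- (ℤ.+ S ℤ.+ ℤ.+ S′)  ≡⟨ cong (λ x → ℤ.+ x ℤ.- (ℤ.+ S ℤ.+ ℤ.+ S′)) balanced ⟩
  ℤ.+ (F′ + S) ℤ.- (ℤ.+ S ℤ.+ ℤ.+ S′)  ≡⟨ cancel-left (ℤ.+ F′) (ℤ.+ S) (ℤ.+ S′) ⟩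
  ℤ.+ F′ ℤ.- ℤ.+ S′                    ∎
  where
  F = Nfirst n w
  S = Nsecond n w
  F′ = Nfirst n w′
  S′ = Nsecond n w′
  balanced : F + S′ ≡ F′ + S
  balanced = +-cancel-balanced {F} {F′} {S} {S′} {W} {W′} {D} {D′} eF eS eW
  add-right : ∀ f s s′ → f ℤ.- s ≡ (f ℤ.+ s′) ℤ.- (s ℤ.+ s′)
  add-right = solve-∀
  cancel-left : ∀ f′ s s′ → (f′ ℤ.+ s) ℤ.- (s ℤ.+ s′) ≡ f′ ℤ.- s′
  cancel-left = solve-∀

N-suc : ∀ {n w w′} → Nfirst n w ≡ Nfirst n w′ → Nsecond n w ≡ Nsecond n w′ + 1 →
        N n w′ ≡ N n w ℤ.+ ℤ.+ 1
N-suc {n} {w} {w′} eF eS rewrite eF | eS = shift (ℤ.+ Nfirst n w′) (ℤ.+ Nsecond n w′)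
  where
  shift : ∀ f s → f ℤ.- s ≡ (f ℤ.- (s ℤ.+ ℤ.+ 1)) ℤ.+ ℤ.+ 1
  shift = solve-∀

pos-head : ∀ a u → pos a (a ∷ u) ≡ 0
pos-head a u rewrite ≡ᵇ-refl a = refl

pos-tail : ∀ {x a} u → a ≢ x → pos x (a ∷ u) ≡ suc (pos x u)
pos-tail u a≢x rewrite ≢⇒≡ᵇ-false a≢x = refl

pos-++-∈ : ∀ {x} u v → x ∈ u → pos x (u ++ v) ≡ pos x u
pos-++-∈ (a ∷ u) v (here refl) = trans (pos-head a (u ++ v)) (sym (pos-head a u))
pos-++-∈ {x} (a ∷ u) v (there x∈u) with a ≟ x
... | yes refl = trans (pos-head a (u ++ v)) (sym (pos-head a u))
... | no  a≢x  =
  trans (pos-tail (u ++ v) a≢x) (trans (cong suc (pos-++-∈ u v x∈u)) (sym (pos-tail u a≢x)))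

pos-last : ∀ {a} u → a ∉ u → pos a (u ++ [ a ]) ≡ length u
pos-last {a} []      _   = pos-head a []
pos-last {a} (x ∷ u) a∉ =
  trans (pos-tail (u ++ [ a ]) λ x≡a → a∉ (here (sym x≡a))) (cong suc (pos-last u λ a∈ → a∉ (there a∈)))

pos-<-length : ∀ {x} u → x ∈ u → pos x u < length u
pos-<-length {x} (a ∷ u) x∈ with a ≟ x
... | yes refl = subst (_< suc (length u)) (sym (pos-head a u)) z<s
... | no  a≢x  =
  subst (_< suc (length u)) (sym (pos-tail u a≢x)) (s<s (pos-<-length u (tail (≢-sym a≢x) x∈)))

pos-≤-length : ∀ x u → pos x u ≤ length u
pos-≤-length x []      = z≤n
pos-≤-length x (a ∷ u) with a ≡ᵇ x
... | true  = z≤n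
... | false = s≤s (pos-≤-length x u)

pos-map-injective : ∀ {f : ℕ → ℕ} → (∀ {x y} → f x ≡ f y → x ≡ y) →
                    ∀ x w → pos (f x) (map f w) ≡ pos x w
pos-map-injective f-inj x []      = refl
pos-map-injective {f} f-inj x (y ∷ w) with y ≟ x
... | yes refl = trans (pos-head (f y) (map f w)) (sym (pos-head y w))
... | no  y≢x  = trans (pos-tail (map f w) (y≢x ∘ f-inj))
                       (trans (cong suc (pos-map-injective f-inj x w)) (sym (pos-tail w y≢x)))

γ-pos : ∀ i j w {p q} → pos i w ≡ p → pos j w ≡ q → γ i j w ≡ 𝟙 (q <ᵇ p)
γ-pos i j w refl refl = refl

γ-rotate : ∀ {a u i j} → a ∉ u → i ∈ a ∷ u → j ∈ a ∷ u → i ≢ j →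
           γ i j (a ∷ u) + 𝟙 (i ≡ᵇ a) ≡ γ i j (u ++ [ a ]) + 𝟙 (j ≡ᵇ a)
γ-rotate a∉u (here refl) (here refl) i≢j = ⊥-elim (i≢j refl)
γ-rotate {a} {u} {j = j} a∉u (here refl) (there j∈u) _ = begin
  γ a j (a ∷ u) + 𝟙 (a ≡ᵇ a)
    ≡⟨ cong₂ _+_ (γ-pos a j (a ∷ u) (pos-head a u) (pos-tail u (≢-sym j≢a)))
                 (cong 𝟙 (≡ᵇ-refl a)) ⟩
  1 ≡⟨ cong (_+ 0) (cong 𝟙 (<⇒<ᵇ-true (pos-<-length u j∈u))) ⟨
  𝟙 (pos j u <ᵇ length u) + 0
    ≡⟨ cong₂ _+_ (γ-pos a j (u ++ [ a ]) (pos-last u a∉u) (pos-++-∈ u [ a ] j∈u))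
                 (cong 𝟙 (≢⇒≡ᵇ-false j≢a)) ⟨
  γ a j (u ++ [ a ]) + 𝟙 (j ≡ᵇ a) ∎
  where j≢a = ∈∧∉⇒≢ j∈u a∉u
γ-rotate {a} {u} {i = i} a∉u (there i∈u) (here refl) _ = begin
  γ i a (a ∷ u) + 𝟙 (i ≡ᵇ a)
    ≡⟨ cong₂ _+_ (γ-pos i a (a ∷ u) (pos-tail u (≢-sym i≢a)) (pos-head a u))
                 (cong 𝟙 (≢⇒≡ᵇ-false i≢a)) ⟩
  1 ≡⟨ cong (λ b → 𝟙 b + 1) (≥⇒<ᵇ-false (pos-≤-length i u)) ⟨
  𝟙 (length u <ᵇ pos i u) + 1
    ≡⟨ cong₂ _+_ (γ-pos i a (u ++ [ a ]) (pos-++-∈ u [ a ] i∈u) (pos-last u a∉u))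
                 (cong 𝟙 (≡ᵇ-refl a)) ⟨
  γ i a (u ++ [ a ]) + 𝟙 (a ≡ᵇ a) ∎
  where i≢a = ∈∧∉⇒≢ i∈u a∉u
γ-rotate {a} {u} {i} {j} a∉u (there i∈u) (there j∈u) _ = begin
  γ i j (a ∷ u) + 𝟙 (i ≡ᵇ a)
    ≡⟨ cong₂ _+_ (γ-pos i j (a ∷ u) (pos-tail u (≢-sym i≢a)) (pos-tail u (≢-sym j≢a)))
                 (cong 𝟙 (≢⇒≡ᵇ-false i≢a)) ⟩
  𝟙 (pos j u <ᵇ pos i u) + 0
    ≡⟨ cong₂ _+_ (γ-pos i j (u ++ [ a ]) (pos-++-∈ u [ a ] i∈u) (pos-++-∈ u [ a ] j∈u))
                 (cong 𝟙 (≢⇒≡ᵇ-false j≢a)) ⟨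
  γ i j (u ++ [ a ]) + 𝟙 (j ≡ᵇ a) ∎
  where
  i≢a = ∈∧∉⇒≢ i∈u a∉u
  j≢a = ∈∧∉⇒≢ j∈u a∉u

record Arrangement (n : ℕ) (w : List ℕ) : Set where
  field
    distinct : Unique w
    complete : ∀ {x} → x ∈ letters n → x ∈ w
    sound    : ∀ {x} → x ∈ w → x ∈ letters n

Arrangement-resp-↭ : ∀ {n w w′} → w ↭ w′ → Arrangement n w → Arrangement n w′
Arrangement-resp-↭ w↭w′ arr = record
  { distinct = Permₛ.Unique-resp-↭ (setoid ℕ) (↭⇒↭ₛ w↭w′) distinct
  ; complete = λ x∈ → ∈-resp-↭ w↭w′ (complete x∈)
  ; sound    = λ x∈ → sound (∈-resp-↭ (↭-sym w↭w′) x∈)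
  }
  where open Arrangement arr

perm⇒Arrangement : ∀ {n w} → IsPerm n w → Arrangement n w
perm⇒Arrangement {n} w↭letters = Arrangement-resp-↭ (↭-sym w↭letters) record
  { distinct = letters-unique n ; complete = λ x∈ → x∈ ; sound = λ x∈ → x∈ }

N-rotate : ∀ {n a u} → Arrangement n (a ∷ u) → N n (a ∷ u) ≡ N n (u ++ [ a ])
N-rotate {n} {a} {u} arr =
  N-cong {n} {a ∷ u} {u ++ [ a ]} {weight n a} {weight n (a ∸ 1)} {n ∸ a} {a ∸ 1}
         first second (weight-step 1≤a a≤n)
  where
  open Arrangement arr
  1≤a = proj₁ (∈-letters⁻ (sound (here refl)))
  a≤n = proj₂ (∈-letters⁻ (sound (here refl)))
  a∉u : a ∉ u
  a∉u a∈u with a≢u ∷ _ ← distinct = All.lookup a≢u a∈u refl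
  moves : MovesLast n a (a ∷ u) (u ++ [ a ])
  moves 1≤i i<j j≤n = γ-rotate a∉u
    (complete (∈-letters⁺ 1≤i (<⇒≤ (<-≤-trans i<j j≤n))))
    (complete (∈-letters⁺ (≤-trans 1≤i (<⇒≤ i<j)) j≤n))
    (<⇒≢ i<j)
  first : Nfirst n (a ∷ u) + weight n a ≡ Nfirst n (u ++ [ a ]) + weight n (a ∸ 1)
  first = Nfirst-movesLast {w = a ∷ u} {u ++ [ a ]} 1≤a a≤n moves
  second : Nsecond n (a ∷ u) + (n ∸ a) ≡ Nsecond n (u ++ [ a ]) + (a ∸ 1)
  second = Nsecond-movesLast {w = a ∷ u} {u ++ [ a ]} 1≤a a≤n moves

N-conjugate : ∀ {n} x y → Arrangement n (x ++ y) → N n (x ++ y) ≡ N n (y ++ x)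
N-conjugate {n} []      y _   = cong (N n) (sym (++-identityʳ y))
N-conjugate {n} (a ∷ x) y arr = begin
  N n (a ∷ x ++ y)          ≡⟨ N-rotate arr ⟩
  N n ((x ++ y) ++ [ a ])   ≡⟨ cong (N n) (++-assoc x y [ a ]) ⟩
  N n (x ++ y ++ [ a ])     ≡⟨ N-conjugate x (y ++ [ a ]) rotated ⟩
  N n ((y ++ [ a ]) ++ x)   ≡⟨ cong (N n) (++-assoc y [ a ] x) ⟩
  N n (y ++ a ∷ x)          ∎
  where
  rotated : Arrangement n (x ++ y ++ [ a ])
  rotated = subst (Arrangement n) (++-assoc x y [ a ]) (Arrangement-resp-↭ (∷↭∷ʳ a (x ++ y)) arr)

N-resp-Conjugate : ∀ {n w w′} → Arrangement n w → Conjugate w w′ → N n w ≡ N n w′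
N-resp-Conjugate arr (x , y , refl , refl) = N-conjugate x y arr

Arrangement-resp-Conjugate : ∀ {n w w′} → Arrangement n w → Conjugate w w′ → Arrangement n w′
Arrangement-resp-Conjugate arr (x , y , refl , refl) = Arrangement-resp-↭ (++-comm x y) arr

factor-Conjugate : ∀ a u b → Conjugate (a ++ u ++ b) (u ++ b ++ a)
factor-Conjugate a u b = a , u ++ b , refl , sym (++-assoc u b a)

data Role (r s : ℕ) : ℕ → Set where
  is-r  : Role r s r
  is-s  : Role r s s
  other : ∀ {x} → x ≢ r → x ≢ s → Role r s x

role : ∀ r s x → Role r s x
role r s x with x ≟ r | x ≟ s
... | yes refl | _        = is-r
... | no  _    | yes refl = is-s
... | no  x≢r  | no  x≢s  = other x≢r x≢s

swapLetter-r : ∀ r s → swapLetter r s r ≡ s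
swapLetter-r r s rewrite ≡ᵇ-refl r = refl

swapLetter-s : ∀ r s → swapLetter r s s ≡ r
swapLetter-s r s with s ≟ r
... | yes refl rewrite ≡ᵇ-refl s = refl
... | no  s≢r  rewrite ≢⇒≡ᵇ-false s≢r | ≡ᵇ-refl s = refl

swapLetter-other : ∀ {r s x} → x ≢ r → x ≢ s → swapLetter r s x ≡ x
swapLetter-other x≢r x≢s rewrite ≢⇒≡ᵇ-false x≢r | ≢⇒≡ᵇ-false x≢s = refl

swapLetter-involutive : ∀ r s x → swapLetter r s (swapLetter r s x) ≡ x
swapLetter-involutive r s x with role r s x
... | is-r = trans (cong (swapLetter r s) (swapLetter-r r s)) (swapLetter-s r s)
... | is-s = trans (cong (swapLetter r s) (swapLetter-s r s)) (swapLetter-r r s)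
... | other x≢r x≢s =
  trans (cong (swapLetter r s) (swapLetter-other x≢r x≢s)) (swapLetter-other x≢r x≢s)

swapLetter-injective : ∀ r s {x y} → swapLetter r s x ≡ swapLetter r s y → x ≡ y
swapLetter-injective r s {x} {y} σx≡σy = begin
  x                                      ≡⟨ swapLetter-involutive r s x ⟨
  swapLetter r s (swapLetter r s x)      ≡⟨ cong (swapLetter r s) σx≡σy ⟩
  swapLetter r s (swapLetter r s y)      ≡⟨ swapLetter-involutive r s y ⟩
  y                                      ∎

swapLetter-∈ : ∀ {r s x} {xs : List ℕ} → r ∈ xs → s ∈ xs → x ∈ xs → swapLetter r s x ∈ xs
swapLetter-∈ {r} {s} {x} r∈ s∈ x∈ with role r s x
... | is-r = subst (_∈ _) (sym (swapLetter-r r s)) s∈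
... | is-s = subst (_∈ _) (sym (swapLetter-s r s)) r∈
... | other x≢r x≢s = subst (_∈ _) (sym (swapLetter-other x≢r x≢s)) x∈

Arrangement-exchange : ∀ {n r s w} → r ∈ letters n → s ∈ letters n →
                       Arrangement n w → Arrangement n (exchange r s w)
Arrangement-exchange {n} {r} {s} {w} r∈ s∈ arr = record
  { distinct = Uniqueₚ.map⁺ (swapLetter-injective r s) distinct
  ; complete = λ {x} x∈ → subst (_∈ exchange r s w) (swapLetter-involutive r s x)
                                (∈-map⁺ (swapLetter r s) (complete (swapLetter-∈ r∈ s∈ x∈)))
  ; sound    = λ x∈ → sound-exchanged (∈-map⁻ (swapLetter r s) x∈)
  }
  where
  open Arrangement arr
  sound-exchanged : ∀ {x} → ∃ (λ y → y ∈ w × x ≡ swapLetter r s y) → x ∈ letters n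
  sound-exchanged (y , y∈ , refl) = swapLetter-∈ r∈ s∈ (sound y∈)

exchange-Conjugate : ∀ {r s w w′} → Conjugate w w′ → Conjugate (exchange r s w) (exchange r s w′)
exchange-Conjugate {r} {s} (x , y , refl , refl) =
  exchange r s x , exchange r s y , map-++ (swapLetter r s) x y , map-++ (swapLetter r s) y x

pos-exchange : ∀ r s x w → pos x (exchange r s w) ≡ pos (swapLetter r s x) w
pos-exchange r s x w = begin
  pos x (exchange r s w)
    ≡⟨ cong (λ y → pos y (exchange r s w)) (swapLetter-involutive r s x) ⟨
  pos (swapLetter r s (swapLetter r s x)) (exchange r s w)
    ≡⟨ pos-map-injective (swapLetter-injective r s) (swapLetter r s x) w ⟩
  pos (swapLetter r s x) w ∎

pos-second : ∀ {a b} t → a ≢ b → pos b (a ∷ b ∷ t) ≡ 1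
pos-second {a} {b} t a≢b = trans (pos-tail (b ∷ t) a≢b) (cong suc (pos-head b t))

pos-rest : ∀ {a b x} t → x ≢ a → x ≢ b → pos x (a ∷ b ∷ t) ≡ 2 + pos x t
pos-rest {a} {b} t x≢a x≢b =
  trans (pos-tail (b ∷ t) (≢-sym x≢a)) (cong suc (pos-tail {a = b} t (≢-sym x≢b)))

𝟙-∧-≢ : ∀ {x r} b → x ≢ r → 𝟙 ((x ≡ᵇ r) ∧ b) ≡ 0
𝟙-∧-≢ b x≢r = cong (λ c → 𝟙 (c ∧ b)) (≢⇒≡ᵇ-false x≢r)

module _ {r s : ℕ} {t t′ : List ℕ} (r<s : r < s)
         (same : ∀ {x} → x ≢ r → x ≢ s → pos x t′ ≡ pos x t) where
  private
    P P′ : List ℕ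
    P  = s ∷ r ∷ t
    P′ = r ∷ s ∷ t′

    r≢s : r ≢ s
    r≢s = <⇒≢ r<s

    P-r : pos r P ≡ 1
    P-r = pos-second t (≢-sym r≢s)

    P-s : pos s P ≡ 0
    P-s = pos-head s (r ∷ t)

    P-other : ∀ {x} → x ≢ r → x ≢ s → pos x P ≡ 2 + pos x t
    P-other x≢r x≢s = pos-rest t x≢s x≢r

    P′-r : pos r P′ ≡ 0
    P′-r = pos-head r (s ∷ t′)

    P′-s : pos s P′ ≡ 1
    P′-s = pos-second t′ r≢s

    P′-other : ∀ {x} → x ≢ r → x ≢ s → pos x P′ ≡ 2 + pos x t
    P′-other x≢r x≢s = trans (pos-rest t′ x≢r x≢s) (cong (2 +_) (same x≢r x≢s))

  γ-swap-front : ∀ {i j} → i < j → γ i j P′ + 𝟙 ((i ≡ᵇ r) ∧ (j ≡ᵇ s)) ≡ γ i j P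
  γ-swap-front {i} {j} i<j with role r s i | role r s j
  ... | is-r | is-r = ⊥-elim (<-irrefl refl i<j)
  ... | is-s | is-s = ⊥-elim (<-irrefl refl i<j)
  ... | is-s | is-r = ⊥-elim (<-asym r<s i<j)
  ... | is-r | is-s = trans
    (cong₂ _+_ (γ-pos r s P′ P′-r P′-s) (cong₂ (λ b c → 𝟙 (b ∧ c)) (≡ᵇ-refl r) (≡ᵇ-refl s)))
    (sym (γ-pos r s P P-r P-s))
  ... | is-r | other j≢r j≢s = trans
    (cong₂ _+_ (γ-pos r j P′ P′-r (P′-other j≢r j≢s))
               (cong₂ (λ b c → 𝟙 (b ∧ c)) (≡ᵇ-refl r) (≢⇒≡ᵇ-false j≢s)))
    (sym (γ-pos r j P P-r (P-other j≢r j≢s)))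
  ... | is-s | other j≢r j≢s = trans
    (cong₂ _+_ (γ-pos s j P′ P′-s (P′-other j≢r j≢s)) (𝟙-∧-≢ (j ≡ᵇ s) (≢-sym r≢s)))
    (sym (γ-pos s j P P-s (P-other j≢r j≢s)))
  ... | other i≢r i≢s | is-r = trans
    (cong₂ _+_ (γ-pos i r P′ (P′-other i≢r i≢s) P′-r) (𝟙-∧-≢ (r ≡ᵇ s) i≢r))
    (sym (γ-pos i r P (P-other i≢r i≢s) P-r))
  ... | other i≢r i≢s | is-s = trans
    (cong₂ _+_ (γ-pos i s P′ (P′-other i≢r i≢s) P′-s) (𝟙-∧-≢ (s ≡ᵇ s) i≢r))
    (sym (γ-pos i s P (P-other i≢r i≢s) P-s))
  ... | other i≢r i≢s | other j≢r j≢s = trans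
    (cong₂ _+_ (γ-pos i j P′ (P′-other i≢r i≢s) (P′-other j≢r j≢s)) (𝟙-∧-≢ (j ≡ᵇ s) i≢r))
    (trans (+-identityʳ _) (sym (γ-pos i j P (P-other i≢r i≢s) (P-other j≢r j≢s))))

exchange-front : ∀ r s t → exchange r s (s ∷ r ∷ t) ≡ r ∷ s ∷ exchange r s t
exchange-front r s t = cong₂ _∷_ (swapLetter-s r s) (cong (_∷ exchange r s t) (swapLetter-r r s))

pos-exchange-other : ∀ {r s x} t → x ≢ r → x ≢ s → pos x (exchange r s t) ≡ pos x t
pos-exchange-other {r} {s} {x} t x≢r x≢s =
  trans (pos-exchange r s x t) (cong (λ y → pos y t) (swapLetter-other x≢r x≢s))

𝟙-adjacent-≢ : ∀ {r s} → suc r ≢ s → ∀ k → 𝟙 ((k ≡ᵇ r) ∧ (suc k ≡ᵇ s)) ≡ 0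
𝟙-adjacent-≢ {r} 1+r≢s k with k ≟ r
... | yes refl = cong₂ (λ b c → 𝟙 (b ∧ c)) (≡ᵇ-refl k) (≢⇒≡ᵇ-false 1+r≢s)
... | no  k≢r  = 𝟙-∧-≢ _ k≢r

N-exchange-front : ∀ {n r s} t → 1 ≤ r → suc r < s → s ≤ n →
                   N n (r ∷ s ∷ exchange r s t) ≡ N n (s ∷ r ∷ t) ℤ.+ ℤ.+ 1
N-exchange-front {n} {r} {s} t 1≤r 1+r<s s≤n = N-suc {n} {P} {P′} Nfirst-unchanged Nsecond-drops
  where
  P P′ : List ℕ
  P  = s ∷ r ∷ t
  P′ = r ∷ s ∷ exchange r s t
  r<s : r < s
  r<s = <-trans (n<1+n r) 1+r<s
  swapped : ∀ {i j} → i < j → γ i j P′ + 𝟙 ((i ≡ᵇ r) ∧ (j ≡ᵇ s)) ≡ γ i j P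
  swapped = γ-swap-front {t = t} {exchange r s t} r<s (pos-exchange-other t)
  Nfirst-unchanged : Nfirst n P ≡ Nfirst n P′
  Nfirst-unchanged = sum-map-cong (letters (n ∸ 1)) λ {k} _ → cong (weight n k *_) (begin
    γ k (suc k) P                                  ≡⟨ swapped (n<1+n k) ⟨
    γ k (suc k) P′ + 𝟙 ((k ≡ᵇ r) ∧ (suc k ≡ᵇ s))   ≡⟨ cong (γ k (suc k) P′ +_) (𝟙-adjacent-≢ (<⇒≢ 1+r<s) k) ⟩
    γ k (suc k) P′ + 0                             ≡⟨ +-identityʳ _ ⟩
    γ k (suc k) P′                                 ∎)
  Nsecond-drops : Nsecond n P ≡ Nsecond n P′ + 1
  Nsecond-drops = begin
    Nsecond n P
      ≡⟨ sumPairs-cong n (λ _ i<j _ → swapped i<j) ⟨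
    sumPairs n (λ i j → γ i j P′ + 𝟙 ((i ≡ᵇ r) ∧ (j ≡ᵇ s)))
      ≡⟨ sumPairs-+ n (λ i j → γ i j P′) (λ i j → 𝟙 ((i ≡ᵇ r) ∧ (j ≡ᵇ s))) ⟩
    Nsecond n P′ + sumPairs n (λ i j → 𝟙 ((i ≡ᵇ r) ∧ (j ≡ᵇ s)))
      ≡⟨ cong (Nsecond n P′ +_) (sumPairs-single n 1≤r r<s s≤n) ⟩
    Nsecond n P′ + 1 ∎

N-exchange : ∀ {n r s w} → Arrangement n w → r ∈ letters n → s ∈ letters n → suc r < s →
             CircularFactor (s ∷ r ∷ []) w → N n (exchange r s w) ≡ N n w ℤ.+ ℤ.+ 1
N-exchange {n} {r} {s} {w} arr r∈ s∈ 1+r<s (_ , w~c , a , b , refl) = begin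
  N n (exchange r s w)
    ≡⟨ N-resp-Conjugate (Arrangement-exchange r∈ s∈ arr) (exchange-Conjugate w~c) ⟩
  N n (exchange r s (a ++ s ∷ r ∷ b))
    ≡⟨ N-resp-Conjugate (Arrangement-exchange r∈ s∈ c-arr) (exchange-Conjugate c~front) ⟩
  N n (exchange r s (s ∷ r ∷ t))
    ≡⟨ cong (N n) (exchange-front r s t) ⟩
  N n (r ∷ s ∷ exchange r s t)
    ≡⟨ N-exchange-front t (proj₁ (∈-letters⁻ r∈)) 1+r<s (proj₂ (∈-letters⁻ s∈)) ⟩
  N n (s ∷ r ∷ t) ℤ.+ ℤ.+ 1
    ≡⟨ cong (λ z → z ℤ.+ ℤ.+ 1) (trans (N-resp-Conjugate arr w~c)
                                       (N-resp-Conjugate c-arr c~front)) ⟨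
  N n w ℤ.+ ℤ.+ 1 ∎
  where
  t = b ++ a
  c~front : Conjugate (a ++ s ∷ r ∷ b) (s ∷ r ∷ t)
  c~front = factor-Conjugate a (s ∷ r ∷ []) b
  c-arr : Arrangement n (a ++ s ∷ r ∷ b)
  c-arr = Arrangement-resp-Conjugate arr w~c

n+nC2≡[n+1]C2 : ∀ n → n + n C 2 ≡ suc n C 2
n+nC2≡[n+1]C2 n = trans (cong (_+ n C 2) (sym (nC1≡n n))) (nCk+nC[k+1]≡[n+1]C[k+1] n 1)

sum-letters-∸ : ∀ n → sum (map (n ∸_) (letters n)) ≡ n C 2
sum-letters-∸ zero    = refl
sum-letters-∸ (suc n) = begin
  sum (map (suc n ∸_) (letters (suc n))) ≡⟨ sum-letters-suc n (suc n ∸_) ⟩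
  n + sum (map (n ∸_) (letters n))       ≡⟨ cong (n +_) (sum-letters-∸ n) ⟩
  n + n C 2                              ≡⟨ n+nC2≡[n+1]C2 n ⟩
  suc n C 2                              ∎

sum-weights : ∀ n → sum (map (weight n) (letters n)) ≡ suc n C 3
sum-weights zero    = refl
sum-weights (suc n) = begin
  sum (map (weight (suc n)) (letters (suc n)))
    ≡⟨ sum-letters-suc n (weight (suc n)) ⟩
  1 * n + sum (map (λ k → (n ∸ k) + weight n k) (letters n))
    ≡⟨ cong₂ _+_ (*-identityˡ n) (sum-map-+ (letters n) (n ∸_) (weight n)) ⟩
  n + (sum (map (n ∸_) (letters n)) + sum (map (weight n) (letters n)))
    ≡⟨ cong₂ (λ x y → n + (x + y)) (sum-letters-∸ n) (sum-weights n) ⟩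
  n + (n C 2 + suc n C 3)    ≡⟨ +-assoc n _ _ ⟨
  n + n C 2 + suc n C 3      ≡⟨ cong (_+ suc n C 3) (n+nC2≡[n+1]C2 n) ⟩
  suc n C 2 + suc n C 3      ≡⟨ nCk+nC[k+1]≡[n+1]C[k+1] (suc n) 2 ⟩
  suc (suc n) C 3            ∎

sum-weights-pred : ∀ n → sum (map (weight n) (letters (n ∸ 1))) ≡ n C 3 + n C 2
sum-weights-pred zero    = refl
sum-weights-pred (suc n) = begin
  sum (map (weight (suc n)) (letters n))
    ≡⟨ +-identityʳ _ ⟨
  sum (map (weight (suc n)) (letters n)) + 0
    ≡⟨ cong (sum (map (weight (suc n)) (letters n)) +_) (weight-self (suc n)) ⟨
  sum (map (weight (suc n)) (letters n)) + weight (suc n) (suc n)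
    ≡⟨ sum-letters-∷ʳ n (weight (suc n)) ⟨
  sum (map (weight (suc n)) (letters (suc n)))
    ≡⟨ sum-weights (suc n) ⟩
  suc (suc n) C 3            ≡⟨ nCk+nC[k+1]≡[n+1]C[k+1] (suc n) 2 ⟨
  suc n C 2 + suc n C 3      ≡⟨ +-comm (suc n C 2) _ ⟩
  suc n C 3 + suc n C 2      ∎

sumPairs-one : ∀ n → sumPairs n (λ _ _ → 1) ≡ n C 2
sumPairs-one n = trans
  (sum-map-cong (letters n) λ {i} _ → trans (sum-map-one (upTo (n ∸ i))) (length-upTo (n ∸ i)))
  (sum-letters-∸ n)

pos-letters : ∀ {n x} → 1 ≤ x → x ≤ n → pos x (letters n) ≡ x ∸ 1
pos-letters {suc n} {1}           _ _         = cong (pos 1) (letters-suc n)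
pos-letters {suc n} {suc (suc x)} _ (s≤s x<n) = begin
  pos (2 + x) (letters (suc n))            ≡⟨ cong (pos (2 + x)) (letters-suc n) ⟩
  suc (pos (2 + x) (map suc (letters n)))  ≡⟨ cong suc (pos-map-injective suc-injective _ (letters n)) ⟩
  suc (pos (suc x) (letters n))            ≡⟨ cong suc (pos-letters (s≤s z≤n) x<n) ⟩
  suc x                                    ∎

pos-downFrom : ∀ {n y} → y < n → pos y (downFrom n) ≡ n ∸ suc y
pos-downFrom {suc n} {y} (s≤s y≤n) with n ≟ y
... | yes refl = trans (pos-head n (downFrom n)) (sym (n∸n≡0 n))
... | no  n≢y  =
  trans (pos-tail (downFrom n) n≢y) (trans (cong suc (pos-downFrom y<n)) (sym (+-∸-assoc 1 y<n)))
  where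
  y<n : y < n
  y<n = ≤∧≢⇒< y≤n (≢-sym n≢y)

pos-reverse-letters : ∀ {n x} → 1 ≤ x → x ≤ n → pos x (reverse (letters n)) ≡ n ∸ x
pos-reverse-letters {n} {suc y} _ y<n = begin
  pos (suc y) (reverse (letters n))     ≡⟨ cong (pos (suc y)) (reverse-map suc (upTo n)) ⟨
  pos (suc y) (map suc (reverse (upTo n))) ≡⟨ cong (pos (suc y) ∘ map suc) (reverse-upTo n) ⟩
  pos (suc y) (map suc (downFrom n))    ≡⟨ pos-map-injective suc-injective y (downFrom n) ⟩
  pos y (downFrom n)                    ≡⟨ pos-downFrom y<n ⟩
  n ∸ suc y                             ∎

γ-letters : ∀ {n i j} → 1 ≤ i → i < j → j ≤ n → γ i j (letters n) ≡ 0
γ-letters {n} {i} {j} 1≤i i<j j≤n = trans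
  (γ-pos i j (letters n) (pos-letters 1≤i (<⇒≤ (<-≤-trans i<j j≤n)))
                         (pos-letters (≤-trans 1≤i (<⇒≤ i<j)) j≤n))
  (cong 𝟙 (≥⇒<ᵇ-false (∸-monoˡ-≤ 1 (<⇒≤ i<j))))

γ-reverse-letters : ∀ {n i j} → 1 ≤ i → i < j → j ≤ n → γ i j (reverse (letters n)) ≡ 1
γ-reverse-letters {n} {i} {j} 1≤i i<j j≤n = trans
  (γ-pos i j (reverse (letters n)) (pos-reverse-letters 1≤i (<⇒≤ (<-≤-trans i<j j≤n)))
                                   (pos-reverse-letters (≤-trans 1≤i (<⇒≤ i<j)) j≤n))
  (cong 𝟙 (<⇒<ᵇ-true (∸-monoʳ-< i<j j≤n)))

N-letters : ∀ n → N n (letters n) ≡ ℤ.+ 0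
N-letters n = cong₂ (λ F S → ℤ.+ F ℤ.- ℤ.+ S) Nfirst≡0 Nsecond≡0
  where
  Nfirst≡0 : Nfirst n (letters n) ≡ 0
  Nfirst≡0 = sum-map-zero (letters (n ∸ 1)) λ {k} k∈ → let 1≤k , 1+k≤n = ∈-letters-pred⁻ k∈ in
    trans (cong (weight n k *_) (γ-letters {n} 1≤k (n<1+n k) 1+k≤n)) (*-zeroʳ (weight n k))
  Nsecond≡0 : Nsecond n (letters n) ≡ 0
  Nsecond≡0 = trans (sumPairs-cong n (γ-letters {n})) (sumPairs-zero n)

N-reverse-letters : ∀ n → N n (reverse (letters n)) ≡ ℤ.+ (n C 3)
N-reverse-letters n = begin
  ℤ.+ Nfirst n w ℤ.- ℤ.+ Nsecond n w     ≡⟨ cong₂ (λ F S → ℤ.+ F ℤ.- ℤ.+ S) Nfirst≡ Nsecond≡ ⟩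
  ℤ.+ (n C 3 + n C 2) ℤ.- ℤ.+ (n C 2)   ≡⟨ cancel (ℤ.+ (n C 3)) (ℤ.+ (n C 2)) ⟩
  ℤ.+ (n C 3)                           ∎
  where
  w = reverse (letters n)
  Nfirst≡ : Nfirst n w ≡ n C 3 + n C 2
  Nfirst≡ = trans
    (sum-map-cong (letters (n ∸ 1)) λ {k} k∈ → let 1≤k , 1+k≤n = ∈-letters-pred⁻ k∈ in
       trans (cong (weight n k *_) (γ-reverse-letters {n} 1≤k (n<1+n k) 1+k≤n)) (*-identityʳ (weight n k)))
    (sum-weights-pred n)
  Nsecond≡ : Nsecond n w ≡ n C 2
  Nsecond≡ = trans (sumPairs-cong n (γ-reverse-letters {n})) (sumPairs-one n)
  cancel : ∀ x y → (x ℤ.+ y) ℤ.- y ≡ x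
  cancel = solve-∀

proposition2p1 : (n : ℕ) → 1 ≤ n →
    ((w w′ : List ℕ) → IsPerm n w → IsPerm n w′ → Conjugate w w′ → N n w ≡ N n w′)
    × ((w : List ℕ) (s r : ℕ) → IsPerm n w → s ∈ letters n → r ∈ letters n → suc r < s →
    CircularFactor (s ∷ r ∷ []) w → N n (exchange r s w) ≡ N n w ℤ.+ ℤ.+ 1)
    × (N n (letters n) ≡ ℤ.+ 0)
    × (N n (reverse (letters n)) ≡ ℤ.+ (n C 3))
proposition2p1 n _ =
    (λ w w′ w-perm _ w~w′ → N-resp-Conjugate (perm⇒Arrangement w-perm) w~w′)
  , (λ w s r w-perm s∈ r∈ 1+r<s sr-factor →
       N-exchange (perm⇒Arrangement w-perm) r∈ s∈ 1+r<s sr-factor)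
  , N-letters n
  , N-reverse-letters n
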